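{- Let $h \geq 1$ be an integer, $q_0 := 2^h$, $q := 2q_0^2$, and let $S := \langle q,\ q+q_0,\ q+2q_0,\ q+2q_0+1\rangle$ (the Suzuki semigroup). Put $s := (q_0-1)(q+q_0)$. Then $\sigma$ attains its maximum over $S \cap [0,c(S)]$ at $s$, and $$\sigma(s) = \frac{q_0}{12}\left(4q - 3q_0 - 8\right).$$
   Context: A numerical semigroup is a subset $S \subseteq \mathbb{N} = \{0,1,2,\ldots\}$ closed under addition, containing $0$, with finite complement. Its Frobenius number is $F(S) := \max(\mathbb{N}\setminus S)$ and its conductor is $c(S) := F(S)+1$. For $s \in S \cap [0,c(S)]$ define $\sigma(s) := \frac{s}{2} - |S \cap [0,s]| + 1$. -}

module Defs where

open import Data.Nat using (ℕ; zero; suc; _+_; _*_; _∸_; _^_; _≤ᵇ_; _≡ᵇ_; _<_)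
open import Data.Bool using (Bool; T; _∧_)
open import Data.List using (List; []; _∷_; upTo; length; filterᵇ)
open import Data.Bool.ListAction using (any)
open import Data.Integer using (ℤ; +_)
import Data.Integer as ℤ
open import Data.Rational using (ℚ; _/_; _-_; 1ℚ)
import Data.Rational as ℚ
open import Data.Product using (_×_)
open import Relation.Nullary using (¬_)

-- Membership in the numerical semigroup generated by a list of generators:
-- n ∈ ⟨g₁,…,g_k⟩ iff n = Σ kᵢ gᵢ for some kᵢ ∈ ℕ.
memb : List ℕ → ℕ → Bool
memb []       n = n ≡ᵇ 0
memb (g ∷ gs) n = any (λ k → (k * g ≤ᵇ n) ∧ memb gs (n ∸ k * g)) (upTo (suc n))

_∈⟨_⟩ : ℕ → List ℕ → Set
n ∈⟨ gs ⟩ = T (memb gs n)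

IsFrobenius : List ℕ → ℕ → Set
IsFrobenius gs F = ¬ (F ∈⟨ gs ⟩) × (∀ n → F < n → n ∈⟨ gs ⟩)

count : List ℕ → ℕ → ℕ
count gs s = length (filterᵇ (memb gs) (upTo (suc s)))

σ : List ℕ → ℕ → ℚ
σ gs s = ((+ s) / 2 - (+ count gs s) / 1) ℚ.+ 1ℚ

q₀ : ℕ → ℕ
q₀ h = 2 ^ h

q : ℕ → ℕ
q h = 2 * q₀ h * q₀ h

suzuki : ℕ → List ℕ
suzuki h = q h ∷ (q h + q₀ h) ∷ (q h + 2 * q₀ h) ∷ (q h + 2 * q₀ h + 1) ∷ []

-- For t ∈ S one has σ(t) = w(t)/2, where w(t) is the number of gaps of S below t minus the number of
-- its elements below t, so the claim is that w peaks over [0, F + 1] at s. Since S is symmetric,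
-- w(t) = w(F + 1 − t), and it suffices to look at t ≤ q₀ q. There every t is uniquely k q + j q₀ + c with
-- j < 2q₀ and c < q₀, and t ∈ S iff 2c ≤ j ≤ 2k: row j of level k starts with ⌊j/2⌋ + 1 elements
-- (if j ≤ 2k) followed by gaps. So w is largest at row starts; within level k it rises up to row
-- q₀ − 1, falls until row 2k + 1 and rises again, and comparing levels puts the maximum at row q₀ − 1
-- of level q₀ − 1, which is s.
module Submission where

open import Defs using (memb; σ; count; IsFrobenius; _∈⟨_⟩)
open import Data.Bool using (Bool; T)
open import Data.Bool.Properties using (T-∧)
open import Data.Empty using (⊥-elim)
open import Data.Integer as ℤ using (ℤ; +≤+)
import Data.Integer.Properties as ℤP
import Data.Integer.Tactic.RingSolver as ℤ-Solver
open import Data.List using (List; []; _∷_; [_]; _++_; upTo; drop; length; filterᵇ)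
open import Data.List.Properties using (upTo-∷ʳ; filter-++; filter-accept; filter-reject; length-++)
open import Data.List.Membership.Propositional using (find; lose)
open import Data.List.Membership.Propositional.Properties using (∈-upTo⁺)
open import Data.List.Relation.Unary.Any.Properties using (any⁺; any⁻)
open import Data.Nat
open import Data.Nat.DivMod using (_/_; _%_; m≡m%n+[m/n]*n; m%n<n; m<n*o⇒m/o<n; [m+kn]%n≡m%n; m<n⇒m%n≡m)
open import Data.Nat.Properties
open import Data.Nat.Tactic.RingSolver using (solve-∀)
open import Data.Product using (Σ; ∃-syntax; _×_; _,_; proj₁; proj₂)
open import Data.Rational as ℚ using (ℚ; toℚᵘ)
import Data.Rational.Properties as ℚP
open import Data.Rational.Unnormalised as ℚᵘ using (mkℚᵘ; *≡*; *≤*)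
import Data.Rational.Unnormalised.Properties as ℚᵘP
open import Data.Sum using (_⊎_; inj₁; inj₂; [_,_]′; swap)
open import Data.Unit using (tt)
open import Function using (_∘_; _⇔_; mk⇔; Equivalence)
open import Relation.Binary.Bundles using (Preorder)
import Relation.Binary.Construct.Flip.EqAndOrd as Flip
open import Relation.Binary.Definitions using (tri<; tri≈; tri>)
open import Relation.Binary.PropositionalEquality hiding ([_])
open import Relation.Nullary using (¬_; yes; no; contradiction)
open import Relation.Nullary.Decidable using (T?)

2⌊n/2⌋≤n : ∀ n → 2 * ⌊ n /2⌋ ≤ n
2⌊n/2⌋≤n zero          = z≤n
2⌊n/2⌋≤n (suc zero)    = z≤n
2⌊n/2⌋≤n (suc (suc n)) = subst (_≤ suc (suc n)) (sym (+-suc (suc ⌊ n /2⌋) (⌊ n /2⌋ + 0)))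
                           (s≤s (s≤s (2⌊n/2⌋≤n n)))

n≤1+2⌊n/2⌋ : ∀ n → n ≤ 1 + 2 * ⌊ n /2⌋
n≤1+2⌊n/2⌋ zero          = z≤n
n≤1+2⌊n/2⌋ (suc zero)    = s≤s z≤n
n≤1+2⌊n/2⌋ (suc (suc n)) = subst (suc (suc n) ≤_) (cong suc (sym (+-suc (suc ⌊ n /2⌋) (⌊ n /2⌋ + 0))))
                             (s≤s (s≤s (n≤1+2⌊n/2⌋ n)))

m≤⌊n/2⌋⇒2m≤n : ∀ {m} n → m ≤ ⌊ n /2⌋ → 2 * m ≤ n
m≤⌊n/2⌋⇒2m≤n n m≤ = ≤-trans (*-monoʳ-≤ 2 m≤) (2⌊n/2⌋≤n n)

2m≤n⇒m≤⌊n/2⌋ : ∀ {m} n → 2 * m ≤ n → m ≤ ⌊ n /2⌋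
2m≤n⇒m≤⌊n/2⌋ {m} n 2m≤n = ≤-pred (*-cancelˡ-< 2 m (suc ⌊ n /2⌋)
  (≤-trans (s≤s 2m≤n) (≤-trans (s≤s (n≤1+2⌊n/2⌋ n)) (≤-reflexive (sym (*-suc 2 ⌊ n /2⌋))))))

2m≤1+2n⇒m≤n : ∀ {m n} → 2 * m ≤ 1 + 2 * n → m ≤ n
2m≤1+2n⇒m≤n {m} {n} le = m<1+n⇒m≤n (*-cancelˡ-< 2 m (suc n) (≤-trans (s≤s le) (≤-reflexive (sym (*-suc 2 n)))))

⌊2n/2⌋≡n : ∀ n → ⌊ 2 * n /2⌋ ≡ n
⌊2n/2⌋≡n zero    = refl
⌊2n/2⌋≡n (suc n) = trans (cong ⌊_/2⌋ (*-suc 2 n)) (cong suc (⌊2n/2⌋≡n n))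

⌊1+2n/2⌋≡n : ∀ n → ⌊ 1 + 2 * n /2⌋ ≡ n
⌊1+2n/2⌋≡n zero    = refl
⌊1+2n/2⌋≡n (suc n) = trans (cong (⌊_/2⌋ ∘ suc) (*-suc 2 n)) (cong suc (⌊1+2n/2⌋≡n n))

divMod-unique : ∀ {m} .{{_ : NonZero m}} {a b a′ b′} → b < m → b′ < m →
                a * m + b ≡ a′ * m + b′ → a ≡ a′ × b ≡ b′
divMod-unique {m} {a} {b} {a′} {b′} b<m b′<m e = a≡a′ , b≡b′
  where
  remainder : ∀ {a b} → b < m → (a * m + b) % m ≡ b
  remainder {a} {b} b<m = trans (cong (_% m) (+-comm (a * m) b)) (trans ([m+kn]%n≡m%n b a m) (m<n⇒m%n≡m b<m))
  b≡b′ = trans (sym (remainder {a} b<m)) (trans (cong (_% m) e) (remainder {a′} b′<m))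
  a≡a′ = *-cancelʳ-≡ a a′ m (+-cancelʳ-≡ b _ _ (trans e (cong (a′ * m +_) (sym b≡b′))))

j*m+c<a*m : ∀ {j a c m} → j < a → c < m → j * m + c < a * m
j*m+c<a*m {j} {a} {c} {m} j<a c<m = begin-strict
  j * m + c  <⟨ +-monoʳ-< (j * m) c<m ⟩
  j * m + m  ≡⟨ +-comm (j * m) m ⟩
  suc j * m  ≤⟨ *-monoˡ-≤ m j<a ⟩
  a * m      ∎
  where open ≤-Reasoning

module _ {a ℓ₁ ℓ₂} (P : Preorder a ℓ₁ ℓ₂) where
  open Preorder P using (Carrier; _≲_) renaming (refl to ≲-refl; trans to ≲-trans)

  ≲-by-steps : ∀ (f : ℕ → Carrier) {i j} → (∀ k → i ≤ k → k < j → f k ≲ f (suc k)) → i ≤ j → f i ≲ f j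
  ≲-by-steps f step i≤j = go step (≤⇒≤′ i≤j)
    where
    go : ∀ {i j} → (∀ k → i ≤ k → k < j → f k ≲ f (suc k)) → i ≤′ j → f i ≲ f j
    go step ≤′-refl        = ≲-refl
    go step (≤′-step i≤′j) = ≲-trans (go (λ k i≤k k<j → step k i≤k (m<n⇒m<1+n k<j)) i≤′j)
                                     (step _ (≤′⇒≤ i≤′j) (n<1+n _))

ℤ-≤-by-steps : ∀ (f : ℕ → ℤ) {i j} → (∀ k → i ≤ k → k < j → f k ℤ.≤ f (suc k)) → i ≤ j → f i ℤ.≤ f j
ℤ-≤-by-steps = ≲-by-steps ℤP.≤-preorder

ℤ-≥-by-steps : ∀ (f : ℕ → ℤ) {i j} → (∀ k → i ≤ k → k < j → f (suc k) ℤ.≤ f k) → i ≤ j → f j ℤ.≤ f i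
ℤ-≥-by-steps = ≲-by-steps (Flip.preorder ℤP.≤-preorder)

+a-+c≤+b-+d : ∀ {a b c d} → a + d ≤ b + c → ℤ.+ a ℤ.- ℤ.+ c ℤ.≤ ℤ.+ b ℤ.- ℤ.+ d
+a-+c≤+b-+d {a} {b} {c} {d} a+d≤b+c = begin
  ℤ.+ a ℤ.- ℤ.+ c                            ≡⟨ shift (ℤ.+ a) (ℤ.+ c) (ℤ.+ d) ⟩
  (ℤ.+ a ℤ.+ ℤ.+ d) ℤ.- (ℤ.+ c ℤ.+ ℤ.+ d)    ≡⟨ cong (ℤ._- (ℤ.+ c ℤ.+ ℤ.+ d)) (ℤP.pos-+ a d) ⟨
  ℤ.+ (a + d) ℤ.- (ℤ.+ c ℤ.+ ℤ.+ d)          ≤⟨ ℤP.+-monoˡ-≤ (ℤ.- (ℤ.+ c ℤ.+ ℤ.+ d)) (+≤+ a+d≤b+c) ⟩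
  ℤ.+ (b + c) ℤ.- (ℤ.+ c ℤ.+ ℤ.+ d)          ≡⟨ cong (ℤ._- (ℤ.+ c ℤ.+ ℤ.+ d)) (ℤP.pos-+ b c) ⟩
  (ℤ.+ b ℤ.+ ℤ.+ c) ℤ.- (ℤ.+ c ℤ.+ ℤ.+ d)    ≡⟨ unshift (ℤ.+ b) (ℤ.+ c) (ℤ.+ d) ⟩
  ℤ.+ b ℤ.- ℤ.+ d                            ∎
  where
  open ℤP.≤-Reasoning
  shift : ∀ a c d → a ℤ.- c ≡ (a ℤ.+ d) ℤ.- (c ℤ.+ d)
  shift = ℤ-Solver.solve-∀
  unshift : ∀ b c d → (b ℤ.+ c) ℤ.- (c ℤ.+ d) ≡ b ℤ.- d
  unshift = ℤ-Solver.solve-∀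

+a-+c≡+b : ∀ {a b c} → a ≡ b + c → ℤ.+ a ℤ.- ℤ.+ c ≡ ℤ.+ b
+a-+c≡+b {b = b} {c} refl = trans (cong (ℤ._- ℤ.+ c) (ℤP.pos-+ b c)) (cancel (ℤ.+ b) (ℤ.+ c))
  where
  cancel : ∀ b c → b ℤ.+ c ℤ.- c ≡ b
  cancel = ℤ-Solver.solve-∀

+k*[+a-+b] : ∀ k a b → ℤ.+ k ℤ.* (ℤ.+ a ℤ.- ℤ.+ b) ≡ ℤ.+ (k * a) ℤ.- ℤ.+ (k * b)
+k*[+a-+b] k a b = trans (distrib (ℤ.+ k) (ℤ.+ a) (ℤ.+ b)) (sym (cong₂ (λ x y → x ℤ.- y) (ℤP.pos-* k a) (ℤP.pos-* k b)))
  where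
  distrib : ∀ k a b → k ℤ.* (a ℤ.- b) ≡ k ℤ.* a ℤ.- k ℤ.* b
  distrib = ℤ-Solver.solve-∀

module Walk (p : ℕ → Bool) where

  countBelow : ℕ → ℕ
  countBelow t = length (filterᵇ p (upTo t))

  countBelow-suc : ∀ t → countBelow (suc t) ≡ countBelow t + length (filterᵇ p [ t ])
  countBelow-suc t = begin
    length (filterᵇ p (upTo (suc t)))               ≡⟨ cong (length ∘ filterᵇ p) (sym (upTo-∷ʳ t)) ⟩
    length (filterᵇ p (upTo t ++ [ t ]))            ≡⟨ cong length (filter-++ (T? ∘ p) (upTo t) [ t ]) ⟩
    length (filterᵇ p (upTo t) ++ filterᵇ p [ t ])  ≡⟨ length-++ (filterᵇ p (upTo t)) ⟩
    countBelow t + length (filterᵇ p [ t ])       ∎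
    where open ≡-Reasoning

  countBelow-suc-∈ : ∀ {t} → T (p t) → countBelow (suc t) ≡ suc (countBelow t)
  countBelow-suc-∈ {t} pt = trans (countBelow-suc t)
    (trans (cong (λ xs → countBelow t + length xs) (filter-accept (T? ∘ p) {xs = []} pt)) (+-comm _ 1))

  countBelow-suc-∉ : ∀ {t} → ¬ T (p t) → countBelow (suc t) ≡ countBelow t
  countBelow-suc-∉ {t} ¬pt = trans (countBelow-suc t)
    (trans (cong (λ xs → countBelow t + length xs) (filter-reject (T? ∘ p) {xs = []} ¬pt)) (+-identityʳ _))

  -- (gaps of p below t) − (elements of p below t)
  walk : ℕ → ℤ
  walk t = ℤ.+ t ℤ.- ℤ.+ (2 * countBelow t)

  walk-≤ : ∀ a b → a + 2 * countBelow b ≤ b + 2 * countBelow a → walk a ℤ.≤ walk b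
  walk-≤ a b = +a-+c≤+b-+d {a} {b} {2 * countBelow a} {2 * countBelow b}

  walk-≡ : ∀ a b → a + 2 * countBelow b ≡ b + 2 * countBelow a → walk a ≡ walk b
  walk-≡ a b e = ℤP.≤-antisym (walk-≤ a b (≤-reflexive e)) (walk-≤ b a (≤-reflexive (sym e)))

  countBelow-block : ∀ {x e m} → (∀ c → c < m → T (p (x + c)) ⇔ c < e) →
                     ∀ c → c ≤ m → countBelow (x + c) ≡ countBelow x + c ⊓ e
  countBelow-block {x} row zero _ = trans (cong countBelow (+-identityʳ x)) (sym (+-identityʳ _))
  countBelow-block {x} {e} row (suc c) c<m with c <? e
  ... | yes c<e = begin
    countBelow (x + suc c)      ≡⟨ cong countBelow (+-suc x c) ⟩
    countBelow (suc (x + c))    ≡⟨ countBelow-suc-∈ (Equivalence.from (row c c<m) c<e) ⟩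
    suc (countBelow (x + c))    ≡⟨ cong suc (countBelow-block row c (<⇒≤ c<m)) ⟩
    suc (countBelow x + c ⊓ e)  ≡⟨ sym (+-suc _ _) ⟩
    countBelow x + suc (c ⊓ e)  ≡⟨ cong (λ k → countBelow x + suc k) (m≤n⇒m⊓n≡m (<⇒≤ c<e)) ⟩
    countBelow x + suc c        ≡⟨ cong (countBelow x +_) (sym (m≤n⇒m⊓n≡m c<e)) ⟩
    countBelow x + suc c ⊓ e    ∎
    where open ≡-Reasoning
  ... | no c≮e = begin
    countBelow (x + suc c)    ≡⟨ cong countBelow (+-suc x c) ⟩
    countBelow (suc (x + c))  ≡⟨ countBelow-suc-∉ (c≮e ∘ Equivalence.to (row c c<m)) ⟩
    countBelow (x + c)        ≡⟨ countBelow-block row c (<⇒≤ c<m) ⟩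
    countBelow x + c ⊓ e      ≡⟨ cong (countBelow x +_) (trans (m≥n⇒m⊓n≡n e≤c) (sym e⊓)) ⟩
    countBelow x + suc c ⊓ e  ∎
    where
    open ≡-Reasoning
    e≤c = ≮⇒≥ c≮e
    e⊓ = m≥n⇒m⊓n≡n (m≤n⇒m≤1+n e≤c)

  walk-block : ∀ {x e m} → (∀ c → c < m → T (p (x + c)) ⇔ c < e) →
               ∀ c → c ≤ m → walk (x + c) ℤ.≤ walk x ⊎ walk (x + c) ℤ.≤ walk (x + m)
  walk-block {x} {e} {m} row c c≤m with c ≤? e
  ... | yes c≤e = inj₁ (walk-≤ (x + c) x (begin
    x + c + 2 * countBelow x            ≤⟨ m≤m+n _ c ⟩
    x + c + 2 * countBelow x + c        ≡⟨ regroup x c (countBelow x) ⟩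
    x + 2 * (countBelow x + c)          ≡⟨ cong (λ k → x + 2 * (countBelow x + k)) (sym (m≤n⇒m⊓n≡m c≤e)) ⟩
    x + 2 * (countBelow x + c ⊓ e)      ≡⟨ cong (λ k → x + 2 * k) (sym (countBelow-block row c c≤m)) ⟩
    x + 2 * countBelow (x + c)          ∎))
    where
    open ≤-Reasoning
    regroup : ∀ x c C → x + c + 2 * C + c ≡ x + 2 * (C + c)
    regroup = solve-∀
  ... | no c≰e = inj₂ (walk-≤ (x + c) (x + m) (begin
    x + c + 2 * countBelow (x + m)      ≡⟨ cong (λ k → x + c + 2 * k) (countBelow-block row m ≤-refl) ⟩
    x + c + 2 * (countBelow x + m ⊓ e)  ≡⟨ cong (λ k → x + c + 2 * (countBelow x + k)) m⊓e≡c⊓e ⟩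
    x + c + 2 * (countBelow x + c ⊓ e)  ≤⟨ +-monoˡ-≤ _ (+-monoʳ-≤ x c≤m) ⟩
    x + m + 2 * (countBelow x + c ⊓ e)  ≡⟨ cong (λ k → x + m + 2 * k) (sym (countBelow-block row c c≤m)) ⟩
    x + m + 2 * countBelow (x + c)      ∎))
    where
    open ≤-Reasoning
    e≤c = <⇒≤ (≰⇒> c≰e)
    m⊓e≡c⊓e = trans (m≥n⇒m⊓n≡n (≤-trans e≤c c≤m)) (sym (m≥n⇒m⊓n≡n e≤c))

  Symmetric : ℕ → Set
  Symmetric F = ∀ a b → a + b ≡ F → T (p a) ⇔ (¬ T (p b))

  countBelow-symmetric : ∀ {F} → Symmetric F → ∀ u v → u + v ≡ suc F →
                         countBelow u + countBelow (suc F) ≡ u + countBelow v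
  countBelow-symmetric sym-p zero v refl = refl
  countBelow-symmetric {F} sym-p (suc u) v uv≡ with T? (p u)
  ... | yes pu = begin
    countBelow (suc u) + countBelow (suc F)  ≡⟨ cong (_+ countBelow (suc F)) (countBelow-suc-∈ pu) ⟩
    suc (countBelow u + countBelow (suc F))  ≡⟨ cong suc (countBelow-symmetric sym-p u (suc v) (trans (+-suc u v) uv≡)) ⟩
    suc (u + countBelow (suc v))             ≡⟨ cong (λ k → suc (u + k)) (countBelow-suc-∉ (Equivalence.to (sym-p u v u+v≡F) pu)) ⟩
    suc u + countBelow v                     ∎
    where
    open ≡-Reasoning
    u+v≡F = suc-injective uv≡
  ... | no ¬pu = begin
    countBelow (suc u) + countBelow (suc F)  ≡⟨ cong (_+ countBelow (suc F)) (countBelow-suc-∉ ¬pu) ⟩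
    countBelow u + countBelow (suc F)        ≡⟨ countBelow-symmetric sym-p u (suc v) (trans (+-suc u v) uv≡) ⟩
    u + countBelow (suc v)                   ≡⟨ cong (u +_) (countBelow-suc-∈ (Equivalence.from (sym-p v u v+u≡F) ¬pu)) ⟩
    u + suc (countBelow v)                   ≡⟨ +-suc u _ ⟩
    suc u + countBelow v                     ∎
    where
    open ≡-Reasoning
    v+u≡F = trans (+-comm v u) (suc-injective uv≡)

  walk-symmetric : ∀ {F} → Symmetric F → ∀ u v → u + v ≡ suc F → walk u ≡ walk v
  walk-symmetric {F} sym-p u v uv≡ = walk-≡ u v (+-cancelʳ-≡ u _ _ (begin
    u + 2 * Cv + u        ≡⟨ regroup₁ u Cv ⟩
    2 * (u + Cv)          ≡⟨ cong (2 *_) (sym (countBelow-symmetric sym-p u v uv≡)) ⟩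
    2 * (Cu + total)      ≡⟨ regroup₂ Cu total ⟩
    2 * Cu + (total + total)  ≡⟨ cong (2 * Cu +_) (trans halves (sym uv≡)) ⟩
    2 * Cu + (u + v)      ≡⟨ regroup₃ Cu u v ⟩
    v + 2 * Cu + u        ∎))
    where
    open ≡-Reasoning
    Cu = countBelow u
    Cv = countBelow v
    total = countBelow (suc F)
    halves : total + total ≡ suc F
    halves = trans (countBelow-symmetric sym-p (suc F) 0 (+-identityʳ _)) (+-identityʳ _)
    regroup₁ : ∀ u C → u + 2 * C + u ≡ 2 * (u + C)
    regroup₁ = solve-∀
    regroup₂ : ∀ C t → 2 * (C + t) ≡ 2 * C + (t + t)
    regroup₂ = solve-∀
    regroup₃ : ∀ C u v → 2 * C + (u + v) ≡ v + 2 * C + u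
    regroup₃ = solve-∀

  walk-suc-∈ : ∀ {t} → T (p t) → walk (suc t) ≡ walk t ℤ.- ℤ.1ℤ
  walk-suc-∈ {t} pt = begin
    ℤ.+ suc t ℤ.- ℤ.+ (2 * countBelow (suc t))    ≡⟨ cong (λ k → ℤ.+ suc t ℤ.- ℤ.+ (2 * k)) (countBelow-suc-∈ pt) ⟩
    ℤ.+ (1 + t) ℤ.- ℤ.+ (2 * suc C)               ≡⟨ cong₂ ℤ._-_ (ℤP.pos-+ 1 t) (trans (cong ℤ.+_ (*-suc 2 C)) (ℤP.pos-+ 2 (2 * C))) ⟩
    (ℤ.1ℤ ℤ.+ ℤ.+ t) ℤ.- (ℤ.+ 2 ℤ.+ ℤ.+ (2 * C))  ≡⟨ regroup (ℤ.+ t) (ℤ.+ (2 * C)) ⟩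
    ℤ.+ t ℤ.- ℤ.+ (2 * C) ℤ.- ℤ.1ℤ                ∎
    where
    open ≡-Reasoning
    C = countBelow t
    regroup : ∀ t c → (ℤ.1ℤ ℤ.+ t) ℤ.- (ℤ.+ 2 ℤ.+ c) ≡ t ℤ.- c ℤ.- ℤ.1ℤ
    regroup = ℤ-Solver.solve-∀

  walk-up : ∀ x m {e} → countBelow (x + m) ≡ countBelow x + e → 2 * e ≤ m → walk x ℤ.≤ walk (x + m)
  walk-up x m {e} C≡ 2e≤m = walk-≤ x (x + m) (begin
    x + 2 * countBelow (x + m)       ≡⟨ cong (λ k → x + 2 * k) C≡ ⟩
    x + 2 * (countBelow x + e)       ≡⟨ regroup x (countBelow x) e ⟩
    x + 2 * countBelow x + 2 * e     ≤⟨ +-monoʳ-≤ _ 2e≤m ⟩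
    x + 2 * countBelow x + m         ≡⟨ regroup′ x (countBelow x) m ⟩
    x + m + 2 * countBelow x         ∎)
    where
    open ≤-Reasoning
    regroup : ∀ x C e → x + 2 * (C + e) ≡ x + 2 * C + 2 * e
    regroup = solve-∀
    regroup′ : ∀ x C m → x + 2 * C + m ≡ x + m + 2 * C
    regroup′ = solve-∀

  walk-down : ∀ x m {e} → countBelow (x + m) ≡ countBelow x + e → m ≤ 2 * e → walk (x + m) ℤ.≤ walk x
  walk-down x m {e} C≡ m≤2e = walk-≤ (x + m) x (begin
    x + m + 2 * countBelow x         ≡⟨ regroup x m (countBelow x) ⟩
    x + 2 * countBelow x + m         ≤⟨ +-monoʳ-≤ _ m≤2e ⟩
    x + 2 * countBelow x + 2 * e     ≡⟨ regroup′ x (countBelow x) e ⟩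
    x + 2 * (countBelow x + e)       ≡⟨ cong (λ k → x + 2 * k) (sym C≡) ⟩
    x + 2 * countBelow (x + m)       ∎)
    where
    open ≤-Reasoning
    regroup : ∀ x m C → x + m + 2 * C ≡ x + 2 * C + m
    regroup = solve-∀
    regroup′ : ∀ x C e → x + 2 * C + 2 * e ≡ x + 2 * (C + e)
    regroup′ = solve-∀

toℚᵘ-σ : ∀ gs t → toℚᵘ (σ gs t) ℚᵘ.≃ mkℚᵘ (Walk.walk (memb gs) (suc t) ℤ.+ ℤ.1ℤ) 1
toℚᵘ-σ gs t = ℚᵘP.≃-trans homo (*≡* numerators)
  where
  C = count gs t
  half-t = ℤ.+ t ℚ./ 2
  C/1 = ℤ.+ C ℚ./ 1
  homo : toℚᵘ (σ gs t) ℚᵘ.≃ (mkℚᵘ (ℤ.+ t) 1 ℚᵘ.+ ℚᵘ.- mkℚᵘ (ℤ.+ C) 0) ℚᵘ.+ mkℚᵘ (ℤ.+ 1) 0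
  homo = ℚᵘP.≃-trans (ℚP.toℚᵘ-homo-+ (half-t ℚ.- C/1) ℚ.1ℚ)
    (ℚᵘP.+-cong (ℚᵘP.≃-trans (ℚP.toℚᵘ-homo-+ half-t (ℚ.- C/1))
                  (ℚᵘP.+-cong (ℚP.toℚᵘ-fromℚᵘ (mkℚᵘ (ℤ.+ t) 1))
                    (ℚᵘP.≃-trans (ℚP.toℚᵘ-homo‿- C/1) (ℚᵘP.-‿cong (ℚP.toℚᵘ-fromℚᵘ (mkℚᵘ (ℤ.+ C) 0))))))
                (ℚP.toℚᵘ-fromℚᵘ (mkℚᵘ (ℤ.+ 1) 0)))
  numerators : ((ℤ.+ t ℤ.* ℤ.+ 1 ℤ.+ ℤ.- ℤ.+ C ℤ.* ℤ.+ 2) ℤ.* ℤ.+ 1 ℤ.+ ℤ.+ 1 ℤ.* ℤ.+ 2) ℤ.* ℤ.+ 2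
             ≡ (ℤ.+ suc t ℤ.- ℤ.+ (2 * C) ℤ.+ ℤ.1ℤ) ℤ.* ℤ.+ 2
  numerators = trans (collect (ℤ.+ t) (ℤ.+ C))
    (cong₂ (λ a b → (a ℤ.- b ℤ.+ ℤ.1ℤ) ℤ.* ℤ.+ 2) (sym (ℤP.pos-+ 1 t)) (sym (ℤP.pos-* 2 C)))
    where
    collect : ∀ t C → ((t ℤ.* ℤ.+ 1 ℤ.+ ℤ.- C ℤ.* ℤ.+ 2) ℤ.* ℤ.+ 1 ℤ.+ ℤ.+ 1 ℤ.* ℤ.+ 2) ℤ.* ℤ.+ 2
                    ≡ (ℤ.1ℤ ℤ.+ t ℤ.- ℤ.+ 2 ℤ.* C ℤ.+ ℤ.1ℤ) ℤ.* ℤ.+ 2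
    collect = ℤ-Solver.solve-∀

σ-mono : ∀ gs t u → Walk.walk (memb gs) (suc t) ℤ.≤ Walk.walk (memb gs) (suc u) → σ gs t ℚ.≤ σ gs u
σ-mono gs t u w≤w = ℚP.toℚᵘ-cancel-≤
  (ℚᵘP.≤-respʳ-≃ (ℚᵘP.≃-sym (toℚᵘ-σ gs u)) (ℚᵘP.≤-respˡ-≃ (ℚᵘP.≃-sym (toℚᵘ-σ gs t))
    (*≤* (ℤP.*-monoʳ-≤-nonNeg (ℤ.+ 2) (ℤP.+-monoˡ-≤ ℤ.1ℤ w≤w)))))

σ-≡ : ∀ gs t N → ℤ.+ 6 ℤ.* (Walk.walk (memb gs) (suc t) ℤ.+ ℤ.1ℤ) ≡ N → σ gs t ≡ N ℚ./ 12
σ-≡ gs t N six-w≡N = ℚP.toℚᵘ-injective (ℚᵘP.≃-trans (toℚᵘ-σ gs t)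
  (ℚᵘP.≃-trans (*≡* (trans (scale w) (cong (ℤ._* ℤ.+ 2) six-w≡N))) (ℚᵘP.≃-sym (ℚP.toℚᵘ-fromℚᵘ (mkℚᵘ N 11)))))
  where
  w = Walk.walk (memb gs) (suc t) ℤ.+ ℤ.1ℤ
  scale : ∀ w → w ℤ.* ℤ.+ 12 ≡ (ℤ.+ 6 ℤ.* w) ℤ.* ℤ.+ 2
  scale = ℤ-Solver.solve-∀

memb-[]⁻ : ∀ y → T (memb [] y) → y ≡ 0
memb-[]⁻ y = ≡ᵇ⇒≡ y 0

memb-∷⁻ : ∀ g gs x → T (memb (g ∷ gs) x) → ∃[ k ] ∃[ y ] x ≡ k * g + y × T (memb gs y)
memb-∷⁻ g gs x t with find (any⁻ _ (upTo (suc x)) t)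
... | k , _ , t′ with Equivalence.to T-∧ t′
... | kg≤ᵇx , ty = k , x ∸ k * g , sym (m+[n∸m]≡n (≤ᵇ⇒≤ (k * g) x kg≤ᵇx)) , ty

memb-∷⁺ : ∀ g gs k {y} .{{_ : NonZero g}} → T (memb gs y) → T (memb (g ∷ gs) (k * g + y))
memb-∷⁺ g gs k {y} ty = any⁺ _ (lose (∈-upTo⁺ k<) (Equivalence.from T-∧ (≤⇒≤ᵇ (m≤m+n (k * g) y) , ty′)))
  where
  k< : k < suc (k * g + y)
  k< = s≤s (≤-trans (m≤m*n k g) (m≤m+n (k * g) y))
  ty′ : T (memb gs (k * g + y ∸ k * g))
  ty′ = subst (T ∘ memb gs) (sym (m+n∸m≡n (k * g) y)) ty

gens : ℕ → ℕ → List ℕ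
gens n q = q ∷ q + n ∷ q + 2 * n ∷ q + 2 * n + 1 ∷ []

-- a q + b (q + n) + c (q + 2n) + d (q + 2n + 1) = (a + b + c + d) q + (b + 2c + 2d) n + d
InSuzuki : ℕ → ℕ → ℕ → Set
InSuzuki n q x = ∃[ K ] ∃[ J ] ∃[ D ] x ≡ K * q + J * n + D × 2 * D ≤ J × J ≤ 2 * K

memb-gens⁻ : ∀ n q x → T (memb (gens n q) x) → InSuzuki n q x
memb-gens⁻ n q x t
  with a , x₁ , refl , t₁ ← memb-∷⁻ q (drop 1 (gens n q)) x t
  with b , x₂ , refl , t₂ ← memb-∷⁻ (q + n) (drop 2 (gens n q)) x₁ t₁
  with c , x₃ , refl , t₃ ← memb-∷⁻ (q + 2 * n) (drop 3 (gens n q)) x₂ t₂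
  with d , x₄ , refl , t₄ ← memb-∷⁻ (q + 2 * n + 1) [] x₃ t₃
  with refl ← memb-[]⁻ x₄ t₄
  = a + b + c + d , b + 2 * c + 2 * d , d , collect a b c d q n , m≤n+m (2 * d) (b + 2 * c) ,
    subst (b + 2 * c + 2 * d ≤_) (sym (double a b c d)) (m≤m+n _ _)
  where
  collect : ∀ a b c d q n →
    a * q + (b * (q + n) + (c * (q + 2 * n) + (d * (q + 2 * n + 1) + 0)))
      ≡ (a + b + c + d) * q + (b + 2 * c + 2 * d) * n + d
  collect = solve-∀
  double : ∀ a b c d → 2 * (a + b + c + d) ≡ b + 2 * c + 2 * d + (2 * a + b)
  double = solve-∀

memb-gens⁺ : ∀ n q x .{{_ : NonZero q}} → InSuzuki n q x → T (memb (gens n q) x)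
memb-gens⁺ n q x (K , J , D , refl , 2D≤J , J≤2K) =
  subst (T ∘ memb (gens n q)) x≡
    (memb-∷⁺ q (drop 1 (gens n q)) a (memb-∷⁺ (q + n) (drop 2 (gens n q)) b
      (memb-∷⁺ (q + 2 * n) (drop 3 (gens n q)) c (memb-∷⁺ (q + 2 * n + 1) [] D tt))))
  where
  instance
    _ : NonZero (q + n)
    _ = >-nonZero (<-≤-trans (>-nonZero⁻¹ q) (m≤m+n q n))
    _ : NonZero (q + 2 * n)
    _ = >-nonZero (<-≤-trans (>-nonZero⁻¹ q) (m≤m+n q (2 * n)))
    _ : NonZero (q + 2 * n + 1)
    _ = >-nonZero (<-≤-trans (>-nonZero⁻¹ q) (≤-trans (m≤m+n q (2 * n)) (m≤m+n _ 1)))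
  -- the coefficients are d = D and J − 2D = 2c + b with b ≤ 1
  y = J ∸ 2 * D
  c = ⌊ y /2⌋
  b = y ∸ 2 * c
  J≡ : 2 * D + (2 * c + b) ≡ J
  J≡ = trans (cong (2 * D +_) (m+[n∸m]≡n (2⌊n/2⌋≤n y))) (m+[n∸m]≡n 2D≤J)
  b≤1 : b ≤ 1
  b≤1 = subst (b ≤_) (m+n∸n≡m 1 (2 * c)) (∸-monoˡ-≤ (2 * c) (n≤1+2⌊n/2⌋ y))
  bcD≤K : b + c + D ≤ K
  bcD≤K = 2m≤1+2n⇒m≤n (begin
    2 * (b + c + D)           ≡⟨ regroup b c D ⟩
    2 * D + (2 * c + b) + b   ≤⟨ +-mono-≤ (≤-trans (≤-reflexive J≡) J≤2K) b≤1 ⟩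
    2 * K + 1                 ≡⟨ +-comm (2 * K) 1 ⟩
    1 + 2 * K                 ∎)
    where
    open ≤-Reasoning
    regroup : ∀ b c D → 2 * (b + c + D) ≡ 2 * D + (2 * c + b) + b
    regroup = solve-∀
  a = K ∸ (b + c + D)
  x≡ : a * q + (b * (q + n) + (c * (q + 2 * n) + (D * (q + 2 * n + 1) + 0))) ≡ K * q + J * n + D
  x≡ = trans (spread a b c D q n) (cong₂ (λ K J → K * q + J * n + D) (m∸n+n≡m bcD≤K) J≡)
    where
    spread : ∀ a b c D q n →
      a * q + (b * (q + n) + (c * (q + 2 * n) + (D * (q + 2 * n + 1) + 0)))
        ≡ (a + (b + c + D)) * q + (2 * D + (2 * c + b)) * n + D
    spread = solve-∀

InSuzuki-+ : ∀ {n q x y} → InSuzuki n q x → InSuzuki n q y → InSuzuki n q (x + y)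
InSuzuki-+ {n} {q} (K , J , D , refl , 2D≤J , J≤2K) (K′ , J′ , D′ , refl , 2D′≤J′ , J′≤2K′) =
  K + K′ , J + J′ , D + D′ , merge K J D K′ J′ D′ q n ,
  subst (_≤ J + J′) (sym (*-distribˡ-+ 2 D D′)) (+-mono-≤ 2D≤J 2D′≤J′) ,
  subst (J + J′ ≤_) (sym (*-distribˡ-+ 2 K K′)) (+-mono-≤ J≤2K J′≤2K′)
  where
  merge : ∀ K J D K′ J′ D′ q n →
    K * q + J * n + D + (K′ * q + J′ * n + D′) ≡ (K + K′) * q + (J + J′) * n + (D + D′)
  merge = solve-∀

InSuzuki-≤ : ∀ {n q K J D} → 2 * D ≤ J → J ≤ 2 * K → K * q + J * n + D ≤ K * (q + 2 * n + 1)
InSuzuki-≤ {n} {q} {K} {J} {D} 2D≤J J≤2K = begin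
  K * q + J * n + D            ≤⟨ +-mono-≤ (+-monoʳ-≤ (K * q) (*-monoˡ-≤ n J≤2K)) D≤K ⟩
  K * q + 2 * K * n + K        ≡⟨ expand K q n ⟩
  K * (q + 2 * n + 1)          ∎
  where
  open ≤-Reasoning
  D≤K = *-cancelˡ-≤ 2 (≤-trans 2D≤J J≤2K)
  expand : ∀ K q n → K * q + 2 * K * n + K ≡ K * (q + 2 * n + 1)
  expand = solve-∀

stairs : ℕ → ℕ
stairs zero    = 0
stairs (suc j) = stairs j + suc ⌊ j /2⌋

stairs-even : ∀ a → stairs (2 * a) ≡ a * suc a
stairs-odd  : ∀ a → stairs (1 + 2 * a) ≡ suc a * suc a
stairs-even zero    = refl
stairs-even (suc a) = begin
  stairs (2 * suc a)                       ≡⟨ cong stairs (*-suc 2 a) ⟩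
  stairs (1 + 2 * a) + suc ⌊ 1 + 2 * a /2⌋ ≡⟨ cong₂ (λ x y → x + suc y) (stairs-odd a) (⌊1+2n/2⌋≡n a) ⟩
  suc a * suc a + suc a                    ≡⟨ +-comm (suc a * suc a) (suc a) ⟩
  suc a + suc a * suc a                    ≡⟨ *-suc (suc a) (suc a) ⟨
  suc a * suc (suc a)                      ∎
  where open ≡-Reasoning
stairs-odd a = begin
  stairs (2 * a) + suc ⌊ 2 * a /2⌋  ≡⟨ cong₂ (λ x y → x + suc y) (stairs-even a) (⌊2n/2⌋≡n a) ⟩
  a * suc a + suc a                 ≡⟨ +-comm (a * suc a) (suc a) ⟩
  suc a * suc a                     ∎
  where open ≡-Reasoning

stairs-mono : ∀ {i j} → i ≤ j → stairs i ≤ stairs j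
stairs-mono = ≲-by-steps ≤-preorder stairs (λ k _ _ → m≤m+n (stairs k) _)

2*stairs≤ : ∀ j → 2 * stairs j ≤ j * suc j
2*stairs≤ zero    = z≤n
2*stairs≤ (suc j) = begin
  2 * (stairs j + suc ⌊ j /2⌋)          ≡⟨ *-distribˡ-+ 2 (stairs j) _ ⟩
  2 * stairs j + 2 * suc ⌊ j /2⌋        ≡⟨ cong (2 * stairs j +_) (*-suc 2 ⌊ j /2⌋) ⟩
  2 * stairs j + (2 + 2 * ⌊ j /2⌋)      ≤⟨ +-mono-≤ (2*stairs≤ j) (+-monoʳ-≤ 2 (2⌊n/2⌋≤n j)) ⟩
  j * suc j + (2 + j)                   ≤⟨ m≤m+n _ j ⟩
  j * suc j + (2 + j) + j               ≡⟨ step j ⟩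
  suc j * suc (suc j)                   ∎
  where
  open ≤-Reasoning
  step : ∀ j → j * suc j + (2 + j) + j ≡ suc j * suc (suc j)
  step = solve-∀

sumSquares : ℕ → ℕ
sumSquares zero    = 0
sumSquares (suc k) = sumSquares k + suc k * suc k

6*sumSquares : ∀ k → 6 * sumSquares k ≡ k * suc k * (1 + 2 * k)
6*sumSquares zero    = refl
6*sumSquares (suc k) = begin
  6 * (sumSquares k + suc k * suc k)        ≡⟨ *-distribˡ-+ 6 (sumSquares k) _ ⟩
  6 * sumSquares k + 6 * (suc k * suc k)    ≡⟨ cong (_+ 6 * (suc k * suc k)) (6*sumSquares k) ⟩
  k * suc k * (1 + 2 * k) + 6 * (suc k * suc k)  ≡⟨ step k ⟩
  suc k * suc (suc k) * (1 + 2 * suc k)     ∎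
  where
  open ≡-Reasoning
  step : ∀ k → k * suc k * (1 + 2 * k) + 6 * (suc k * suc k) ≡ suc k * suc (suc k) * (1 + 2 * suc k)
  step = solve-∀

-- the number of elements of the Suzuki semigroup in row j of level k, see inS-row⇔
rowSize : ℕ → ℕ → ℕ
rowSize k j with j ≤? 2 * k
... | yes _ = suc ⌊ j /2⌋
... | no  _ = 0

rowSize-low : ∀ {k j} → j ≤ 2 * k → rowSize k j ≡ suc ⌊ j /2⌋
rowSize-low {k} {j} j≤2k with j ≤? 2 * k
... | yes _    = refl
... | no j≰2k = contradiction j≤2k j≰2k

rowSize-high : ∀ {k j} → ¬ j ≤ 2 * k → rowSize k j ≡ 0
rowSize-high {k} {j} j≰2k with j ≤? 2 * k
... | yes j≤2k = contradiction j≤2k j≰2k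
... | no _     = refl

rowSize≤1+⌊j/2⌋ : ∀ k j → rowSize k j ≤ suc ⌊ j /2⌋
rowSize≤1+⌊j/2⌋ k j with j ≤? 2 * k
... | yes _ = ≤-refl
... | no _  = z≤n

<rowSize⇔ : ∀ {k j c} → c < rowSize k j ⇔ (2 * c ≤ j × j ≤ 2 * k)
<rowSize⇔ {k} {j} {c} with j ≤? 2 * k
... | yes j≤2k = mk⇔ (λ c<  → m≤⌊n/2⌋⇒2m≤n j (m<1+n⇒m≤n c<) , j≤2k)
                     (λ (2c≤j , _) → s≤s (2m≤n⇒m≤⌊n/2⌋ j 2c≤j))
... | no j≰2k  = mk⇔ (λ ()) (λ (_ , j≤2k) → contradiction j≤2k j≰2k)

stairs-rowSize : ∀ k j → stairs (j ⊓ suc (2 * k)) + rowSize k j ≡ stairs (suc j ⊓ suc (2 * k))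
stairs-rowSize k j with j ≤? 2 * k
... | yes j≤2k = trans (cong (λ a → stairs a + suc ⌊ j /2⌋) (m≤n⇒m⊓n≡m (m≤n⇒m≤1+n j≤2k)))
                       (cong (stairs ∘ suc) (sym (m≤n⇒m⊓n≡m j≤2k)))
... | no j≰2k  = trans (+-identityʳ _)
                       (cong stairs (trans (m≥n⇒m⊓n≡n 2k<j) (cong suc (sym (m≥n⇒m⊓n≡n (<⇒≤ 2k<j))))))
  where 2k<j = ≰⇒> j≰2k

-- The Suzuki semigroup with q₀ = n = 2 + r; counting from 2 keeps q₀ − 1 and q₀ − 2 free of
-- truncated subtraction.
module Suzuki (r : ℕ) where

  n : ℕ
  n = 2 + r

  q : ℕ
  q = 2 * n * n

  S : ℕ → Set
  S = InSuzuki n q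

  -- opaque, so that conversion checking never unfolds memb (gens n q)
  opaque
    inS : ℕ → Bool
    inS = memb (gens n q)

  open Walk inS public

  F : ℕ
  F = (3 + 2 * r) * q + (1 + 2 * r) * n + (1 + r)

  F-gap : F + suc (4 + 2 * r) ≡ (4 + 2 * r) * q
  F-gap = gap r
    where
    gap : ∀ r → (3 + 2 * r) * (2 * (2 + r) * (2 + r)) + (1 + 2 * r) * (2 + r) + (1 + r) + suc (4 + 2 * r)
                ≡ (4 + 2 * r) * (2 * (2 + r) * (2 + r))
    gap = solve-∀

  F<2[2+r]q : F < (2 + r) * q + (2 + r) * q
  F<2[2+r]q = begin-strict
    F                        <⟨ m<m+n F {suc (4 + 2 * r)} z<s ⟩
    F + suc (4 + 2 * r)      ≡⟨ F-gap ⟩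
    (4 + 2 * r) * q          ≡⟨ double r ⟩
    (2 + r) * q + (2 + r) * q ∎
    where
    open ≤-Reasoning
    double : ∀ r → (4 + 2 * r) * (2 * (2 + r) * (2 + r)) ≡ (2 + r) * (2 * (2 + r) * (2 + r)) + (2 + r) * (2 * (2 + r) * (2 + r))
    double = solve-∀

  opaque
    unfolding inS

    inS⇒S : ∀ {x} → T (inS x) → S x
    inS⇒S {x} = memb-gens⁻ n q x

    S⇒inS : ∀ {x} → S x → T (inS x)
    S⇒inS {x} = memb-gens⁺ n q x

  digits : ∀ x → ∃[ k ] ∃[ j ] ∃[ c ] j < 2 * n × c < n × x ≡ k * q + j * n + c
  digits x = x / q , y / n , y % n , m<n*o⇒m/o<n (m%n<n x q) , m%n<n y n , x≡
    where
    y = x % q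
    x≡ : x ≡ x / q * q + y / n * n + y % n
    x≡ = begin
      x                               ≡⟨ m≡m%n+[m/n]*n x q ⟩
      y + x / q * q                   ≡⟨ +-comm y _ ⟩
      x / q * q + y                   ≡⟨ cong (x / q * q +_) (trans (m≡m%n+[m/n]*n y n) (+-comm (y % n) _)) ⟩
      x / q * q + (y / n * n + y % n) ≡⟨ sym (+-assoc (x / q * q) _ _) ⟩
      x / q * q + y / n * n + y % n   ∎
      where open ≡-Reasoning

  digits-unique : ∀ {k j c k′ j′ c′} → j < 2 * n → c < n → j′ < 2 * n → c′ < n →
                  k * q + j * n + c ≡ k′ * q + j′ * n + c′ → k ≡ k′ × j ≡ j′ × c ≡ c′
  digits-unique {k} {j} {c} {k′} {j′} {c′} j< c< j′< c′< e
    with k≡k′ , low≡ ← divMod-unique {q} (j*m+c<a*m j< c<) (j*m+c<a*m j′< c′<)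
                         (trans (sym (+-assoc (k * q) _ _)) (trans e (+-assoc (k′ * q) _ _)))
    with j≡j′ , c≡c′ ← divMod-unique {n} c< c′< low≡
    = k≡k′ , j≡j′ , c≡c′

  F∉S : ¬ S F
  F∉S (K , J , D , F≡ , 2D≤J , J≤2K) with <-cmp K (3 + 2 * r)
  ... | tri< K<3+2r _ _ = <-irrefl refl (begin-strict
    F                                    ≡⟨ F≡ ⟩
    K * q + J * n + D                    ≤⟨ InSuzuki-≤ {n} {q} {K} {J} {D} 2D≤J J≤2K ⟩
    K * (q + 2 * n + 1)                  ≤⟨ *-monoˡ-≤ _ (m<1+n⇒m≤n K<3+2r) ⟩
    (2 + 2 * r) * (q + 2 * n + 1)        <⟨ n<1+n _ ⟩
    suc ((2 + 2 * r) * (q + 2 * n + 1))  ≡⟨ F-just-above r ⟩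
    F                                    ∎)
    where
    open ≤-Reasoning
    F-just-above : ∀ r → suc ((2 + 2 * r) * (2 * (2 + r) * (2 + r) + 2 * (2 + r) + 1))
                          ≡ (3 + 2 * r) * (2 * (2 + r) * (2 + r)) + (1 + 2 * r) * (2 + r) + (1 + r)
    F-just-above = solve-∀
  ... | tri> _ _ 3+2r<K = <-irrefl refl (begin-strict
    F                        <⟨ m<m+n F {suc (4 + 2 * r)} z<s ⟩
    F + suc (4 + 2 * r)      ≡⟨ F-gap ⟩
    (4 + 2 * r) * q          ≤⟨ *-monoˡ-≤ q 3+2r<K ⟩
    K * q                    ≤⟨ ≤-trans (m≤m+n (K * q) (J * n)) (m≤m+n _ D) ⟩
    K * q + J * n + D        ≡⟨ F≡ ⟨
    F                        ∎)
    where
    open ≤-Reasoning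
  ... | tri≈ _ refl _ with J ≤? 1 + 2 * r
  ...   | yes J≤1+2r = <-irrefl refl (begin-strict
    (1 + 2 * r) * n + (1 + r)  ≡⟨ low≡ ⟩
    J * n + D                  ≤⟨ +-mono-≤ (*-monoˡ-≤ n J≤1+2r) D≤r ⟩
    (1 + 2 * r) * n + r        <⟨ +-monoʳ-< _ (n<1+n r) ⟩
    (1 + 2 * r) * n + (1 + r)  ∎)
    where
    open ≤-Reasoning
    low≡ = +-cancelˡ-≡ ((3 + 2 * r) * q) _ _
             (trans (sym (+-assoc ((3 + 2 * r) * q) ((1 + 2 * r) * n) (1 + r))) (trans F≡ (+-assoc ((3 + 2 * r) * q) (J * n) D)))
    D≤r : D ≤ r
    D≤r = 2m≤1+2n⇒m≤n (≤-trans 2D≤J J≤1+2r)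
  ...   | no J≰1+2r = <-irrefl refl (begin-strict
    (1 + 2 * r) * n + (1 + r)  <⟨ +-monoʳ-< ((1 + 2 * r) * n) (n<1+n (suc r)) ⟩
    (1 + 2 * r) * n + n        ≡⟨ next-row r ⟩
    (2 + 2 * r) * n            ≤⟨ *-monoˡ-≤ n (≰⇒> J≰1+2r) ⟩
    J * n                      ≤⟨ m≤m+n (J * n) D ⟩
    J * n + D                  ≡⟨ low≡ ⟨
    (1 + 2 * r) * n + (1 + r)  ∎)
    where
    open ≤-Reasoning
    low≡ = +-cancelˡ-≡ ((3 + 2 * r) * q) _ _
             (trans (sym (+-assoc ((3 + 2 * r) * q) ((1 + 2 * r) * n) (1 + r))) (trans F≡ (+-assoc ((3 + 2 * r) * q) (J * n) D)))
    next-row : ∀ r → (1 + 2 * r) * (2 + r) + (2 + r) ≡ (2 + 2 * r) * (2 + r)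
    next-row = solve-∀

  digits-< : ∀ {k j c} → j < 2 * n → c < n → k * q + j * n + c < suc k * q
  digits-< {k} {j} {c} j<2n c<n = begin-strict
    k * q + j * n + c    ≡⟨ +-assoc (k * q) (j * n) c ⟩
    k * q + (j * n + c)  <⟨ +-monoʳ-< (k * q) (j*m+c<a*m j<2n c<n) ⟩
    k * q + q            ≡⟨ +-comm (k * q) q ⟩
    suc k * q            ∎
    where open ≤-Reasoning

  borrow-row : ∀ {k j c} → j ≤ 1 + 2 * r → 3 + 2 * r ≤ k → c < n → S (suc k * q + j * n + c)
  borrow-row {k} {j} {c} j≤1+2r 3+2r≤k c<n =
    k , j + 2 * n , c , borrow k j c r , ≤-trans (*-monoʳ-≤ 2 (<⇒≤ c<n)) (m≤n+m (2 * n) j) ,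
    ≤-trans (+-monoˡ-≤ (2 * n) j≤1+2r) (≤-trans (n≤1+n _) (≤-trans (≤-reflexive (two-levels r)) (*-monoʳ-≤ 2 3+2r≤k)))
    where
    borrow : ∀ k j c r → suc k * (2 * (2 + r) * (2 + r)) + j * (2 + r) + c
                        ≡ k * (2 * (2 + r) * (2 + r)) + (j + 2 * (2 + r)) * (2 + r) + c
    borrow = solve-∀
    two-levels : ∀ r → suc (1 + 2 * r + 2 * (2 + r)) ≡ 2 * (3 + 2 * r)
    two-levels = solve-∀

  borrow-above : ∀ {k j c} → 3 + 2 * r < k → j ≤ 1 + 2 * r → c < n → S (k * q + j * n + c)
  borrow-above {suc k} (s≤s 3+2r≤k) j≤1+2r c<n = borrow-row {k} j≤1+2r 3+2r≤k c<n

  >F⇒level : ∀ {k j c} → F < k * q + j * n + c → j < 2 * n → c < n → 3 + 2 * r ≤ k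
  >F⇒level {k} {j} {c} F<x j<2n c<n = ≮⇒≥ (λ k<3+2r → <-asym F<x (begin-strict
    k * q + j * n + c  <⟨ digits-< {k} j<2n c<n ⟩
    suc k * q          ≤⟨ *-monoˡ-≤ q k<3+2r ⟩
    (3 + 2 * r) * q    ≤⟨ ≤-trans (m≤m+n _ _) (m≤m+n _ _) ⟩
    F                  ∎))
    where open ≤-Reasoning

  >F⇒S : ∀ x → F < x → S x
  >F⇒S x F<x with digits x
  ... | k , j , c , j<2n , c<n , refl with 2 * c ≤? j
  ...   | yes 2c≤j = k , j , c , refl , 2c≤j , ≤-trans (<⇒≤ j<2n) (*-monoʳ-≤ 2 (≤-trans n≤3+2r 3+2r≤k))
    where
    3+2r≤k = >F⇒level {k} F<x j<2n c<n
    n≤3+2r : n ≤ 3 + 2 * r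
    n≤3+2r = +-mono-≤ (n≤1+n 2) (m≤m+n r (r + 0))
  ...   | no 2c≰j = borrow-above {k} (≤∧≢⇒< (>F⇒level {k} F<x j<2n c<n) 3+2r≢k) j≤1+2r c<n
    where
    j≤1+2r : j ≤ 1 + 2 * r
    j≤1+2r = m<1+n⇒m≤n (<-≤-trans (≰⇒> 2c≰j) (≤-trans (*-monoʳ-≤ 2 (m<1+n⇒m≤n c<n)) (≤-reflexive (even-succ r))))
      where
      even-succ : ∀ r → 2 * suc r ≡ suc (1 + 2 * r)
      even-succ = solve-∀
    3+2r≢k : 3 + 2 * r ≢ k
    3+2r≢k refl = <⇒≱ F<x (+-mono-≤ (+-monoʳ-≤ _ (*-monoˡ-≤ n j≤1+2r)) (m<1+n⇒m≤n c<n))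

  level-< : ∀ {k j c m} → k * q + j * n + c < m * q → k < m
  level-< {k} {j} {c} {m} x<mq = *-cancelʳ-< q k m (≤-<-trans (≤-trans (m≤m+n (k * q) (j * n)) (m≤m+n _ c)) x<mq)

  complement : ∀ k j c K′ J′ D′ {A B C b} → k * q + j * n + c + b ≡ A * q + B * n + C →
               k + K′ ≡ A → j + J′ ≡ B → c + D′ ≡ C → 2 * D′ ≤ J′ → J′ ≤ 2 * K′ → S b
  complement k j c K′ J′ D′ {b = b} e refl refl refl 2D′≤J′ J′≤2K′ =
    K′ , J′ , D′ , +-cancelˡ-≡ (k * q + j * n + c) b _ (trans e (sym (split k j c K′ J′ D′ q n))) , 2D′≤J′ , J′≤2K′
    where
    split : ∀ k j c K′ J′ D′ q n →
      k * q + j * n + c + (K′ * q + J′ * n + D′) ≡ (k + K′) * q + (j + J′) * n + (c + D′)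
    split = solve-∀

  -- F − a = (3 + 2r − k) q + (1 + 2r − j) n + (1 + r − c)
  complement-short-row : ∀ {k j c b} → k * q + j * n + c + b ≡ F → k ≤ 1 + r → c < n → j < 2 * c → S b
  complement-short-row {k} {j} {c} a+b≡F k≤1+r c<n j<2c =
    complement k j c K′ J′ D′ a+b≡F (m+[n∸m]≡n k≤3+2r) (m+[n∸m]≡n j≤1+2r) c+D′ 2D′≤J′ J′≤2K′
    where
    open ≤-Reasoning
    k≤3+2r = ≤-trans k≤1+r (+-mono-≤ (m≤m+n 1 2) (m≤m+n r (r + 0)))
    j≤1+2r : j ≤ 1 + 2 * r
    j≤1+2r = m<1+n⇒m≤n (<-≤-trans j<2c (≤-trans (*-monoʳ-≤ 2 (m<1+n⇒m≤n c<n)) (≤-reflexive (*-suc 2 r))))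
    K′ = 3 + 2 * r ∸ k
    J′ = 1 + 2 * r ∸ j
    D′ = 1 + r ∸ c
    c+D′ : c + D′ ≡ 1 + r
    c+D′ = m+[n∸m]≡n (m<1+n⇒m≤n c<n)
    2D′≤J′ : 2 * D′ ≤ J′
    2D′≤J′ = +-cancelˡ-≤ (2 * c) _ _ (begin
      2 * c + 2 * D′          ≡⟨ *-distribˡ-+ 2 c D′ ⟨
      2 * (c + D′)            ≡⟨ cong (2 *_) c+D′ ⟩
      2 * (1 + r)             ≡⟨ *-suc 2 r ⟩
      suc (1 + 2 * r)         ≡⟨ cong suc (m+[n∸m]≡n j≤1+2r) ⟨
      suc j + J′              ≤⟨ +-monoˡ-≤ J′ j<2c ⟩
      2 * c + J′              ∎)
    J′≤2K′ : J′ ≤ 2 * K′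
    J′≤2K′ = begin
      J′                        ≤⟨ m∸n≤m (1 + 2 * r) j ⟩
      1 + 2 * r                 ≤⟨ +-monoˡ-≤ (2 * r) (m≤m+n 1 3) ⟩
      4 + 2 * r                 ≡⟨ *-distribˡ-+ 2 2 r ⟨
      2 * (2 + r)               ≡⟨ cong (2 *_) (m+n∸m≡n (1 + r) (2 + r)) ⟨
      2 * (1 + r + (2 + r) ∸ (1 + r))  ≡⟨ cong (λ x → 2 * (x ∸ (1 + r))) (level-sum r) ⟩
      2 * (3 + 2 * r ∸ (1 + r)) ≤⟨ *-monoʳ-≤ 2 (∸-monoʳ-≤ (3 + 2 * r) k≤1+r) ⟩
      2 * K′                    ∎
      where
      level-sum : ∀ r → 1 + r + (2 + r) ≡ 3 + 2 * r
      level-sum = solve-∀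

  -- F − a = (2 + 2r − k) q + (5 + 4r − j) n + (1 + r − c), borrowing one level as 2n rows
  complement-long-row : ∀ {k j c b} → k * q + j * n + c + b ≡ F → k ≤ 1 + r → j < 2 * n → c < n → 2 * k < j → S b
  complement-long-row {k} {j} {c} a+b≡F k≤1+r j<2n c<n 2k<j =
    complement k j c K′ J′ D′ (trans a+b≡F (sym (F-borrowed r))) (m+[n∸m]≡n k≤2+2r) j+J′ c+D′ 2D′≤J′ J′≤2K′
    where
    open ≤-Reasoning
    F-borrowed : ∀ r → (2 + 2 * r) * (2 * (2 + r) * (2 + r)) + (5 + 4 * r) * (2 + r) + (1 + r)
                     ≡ (3 + 2 * r) * (2 * (2 + r) * (2 + r)) + (1 + 2 * r) * (2 + r) + (1 + r)
    F-borrowed = solve-∀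
    j≤3+2r : j ≤ 3 + 2 * r
    j≤3+2r = m<1+n⇒m≤n (subst (j <_) (*-distribˡ-+ 2 2 r) j<2n)
    k≤2+2r = ≤-trans k≤1+r (+-mono-≤ (m≤m+n 1 1) (m≤m+n r (r + 0)))
    K′ = 2 + 2 * r ∸ k
    J′ = 5 + 4 * r ∸ j
    D′ = 1 + r ∸ c
    j+J′ : j + J′ ≡ 5 + 4 * r
    j+J′ = m+[n∸m]≡n (≤-trans j≤3+2r (+-mono-≤ (m≤m+n 3 2) (*-monoˡ-≤ r (m≤m+n 2 2))))
    c+D′ : c + D′ ≡ 1 + r
    c+D′ = m+[n∸m]≡n (m<1+n⇒m≤n c<n)
    2D′≤J′ : 2 * D′ ≤ J′
    2D′≤J′ = +-cancelˡ-≤ j _ _ (begin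
      j + 2 * D′                  ≤⟨ +-mono-≤ j≤3+2r (*-monoʳ-≤ 2 (m≤n+m D′ c)) ⟩
      3 + 2 * r + 2 * (c + D′)    ≡⟨ cong (λ x → 3 + 2 * r + 2 * x) c+D′ ⟩
      3 + 2 * r + 2 * (1 + r)     ≡⟨ row-sum r ⟩
      5 + 4 * r                   ≡⟨ j+J′ ⟨
      j + J′                      ∎)
      where
      row-sum : ∀ r → 3 + 2 * r + 2 * (1 + r) ≡ 5 + 4 * r
      row-sum = solve-∀
    J′≤2K′ : J′ ≤ 2 * K′
    J′≤2K′ = +-cancelˡ-≤ j _ _ (begin
      j + J′                   ≡⟨ j+J′ ⟩
      5 + 4 * r                ≡⟨ level-sum r ⟩
      1 + 2 * (2 + 2 * r)      ≡⟨ cong (λ x → 1 + 2 * x) (m+[n∸m]≡n k≤2+2r) ⟨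
      1 + 2 * (k + K′)         ≡⟨ cong suc (*-distribˡ-+ 2 k K′) ⟩
      1 + 2 * k + 2 * K′       ≤⟨ +-monoˡ-≤ (2 * K′) 2k<j ⟩
      j + 2 * K′               ∎)
      where
      level-sum : ∀ r → 5 + 4 * r ≡ 1 + 2 * (2 + 2 * r)
      level-sum = solve-∀

  S-cover-low : ∀ {a b} → a + b ≡ F → a < (2 + r) * q → S a ⊎ S b
  S-cover-low {a} {b} a+b≡F a< with digits a
  ... | k , j , c , j<2n , c<n , refl with 2 * c ≤? j | j ≤? 2 * k
  ...   | yes 2c≤j | yes j≤2k = inj₁ (k , j , c , refl , 2c≤j , j≤2k)
  ...   | yes _    | no j≰2k  = inj₂ (complement-long-row a+b≡F (m<1+n⇒m≤n (level-< {k} {j} a<)) j<2n c<n (≰⇒> j≰2k))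
  ...   | no 2c≰j  | _        = inj₂ (complement-short-row a+b≡F (m<1+n⇒m≤n (level-< {k} {j} a<)) c<n (≰⇒> 2c≰j))

  S-cover : ∀ {a b} → a + b ≡ F → S a ⊎ S b
  S-cover {a} {b} a+b≡F with a <? (2 + r) * q
  ... | yes a< = S-cover-low a+b≡F a<
  ... | no a≮ = swap (S-cover-low (trans (+-comm b a) a+b≡F) b<)
    where
    X = (2 + r) * q
    b< : b < X
    b< = +-cancelˡ-< X b X (begin-strict
      X + b                ≤⟨ +-monoˡ-≤ b (≮⇒≥ a≮) ⟩
      a + b                ≡⟨ a+b≡F ⟩
      F                    <⟨ F<2[2+r]q ⟩
      X + X                ∎)
      where open ≤-Reasoning

  inS-symmetric : Symmetric F
  inS-symmetric a b a+b≡F = mk⇔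
    (λ a∈ b∈ → F∉S (subst S a+b≡F (InSuzuki-+ {n} {q} {a} {b} (inS⇒S {a} a∈) (inS⇒S {b} b∈))))
    (λ b∉ → [ S⇒inS {a} , (λ b∈S → ⊥-elim (b∉ (S⇒inS {b} b∈S))) ]′ (S-cover a+b≡F))

  rowStart : ℕ → ℕ → ℕ
  rowStart k j = k * q + j * n

  rowStart-suc : ∀ k j → rowStart k j + n ≡ rowStart k (suc j)
  rowStart-suc k j = trans (+-assoc (k * q) (j * n) n) (cong (k * q +_) (+-comm (j * n) n))

  rowStart-wrap : ∀ k → rowStart k (2 * n) ≡ rowStart (suc k) 0
  rowStart-wrap k = wrap k n
    where
    wrap : ∀ k n → k * (2 * n * n) + 2 * n * n ≡ suc k * (2 * n * n) + 0 * n
    wrap = solve-∀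

  low-representation : ∀ {K J D} → K * q + J * n + D < (2 + r) * q → 2 * D ≤ J → J ≤ 2 * K → J < 2 * n × D < n
  low-representation {K} {J} {D} x< 2D≤J J≤2K =
    ≤-<-trans (≤-trans J≤2K (*-monoʳ-≤ 2 K≤1+r)) (*-monoʳ-< 2 (n<1+n (1 + r))) ,
    ≤-<-trans (*-cancelˡ-≤ 2 (≤-trans 2D≤J J≤2K)) (s≤s K≤1+r)
    where
    K≤1+r = m<1+n⇒m≤n (level-< {K} {J} {D} x<)

  rowStart+< : ∀ {k j c} → k ≤ 1 + r → j < 2 * n → c < n → rowStart k j + c < (2 + r) * q
  rowStart+< {k} k≤1+r j<2n c<n = <-≤-trans (digits-< {k} j<2n c<n) (*-monoˡ-≤ q (s≤s k≤1+r))

  S-digits : ∀ {k j c} → k ≤ 1 + r → j < 2 * n → c < n → S (rowStart k j + c) → 2 * c ≤ j × j ≤ 2 * k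
  S-digits {k} {j} {c} k≤1+r j<2n c<n (K , J , D , e , 2D≤J , J≤2K)
    with J<2n , D<n ← low-representation {K} {J} {D} (subst (_< (2 + r) * q) e (rowStart+< k≤1+r j<2n c<n)) 2D≤J J≤2K
    with refl , refl , refl ← digits-unique {K} {J} {D} {k} {j} {c} J<2n D<n j<2n c<n (sym e)
    = 2D≤J , J≤2K

  inS-row⇔ : ∀ {k j} → k ≤ 1 + r → j < 2 * n → ∀ c → c < n → T (inS (rowStart k j + c)) ⇔ c < rowSize k j
  inS-row⇔ {k} {j} k≤1+r j<2n c c<n = mk⇔
    (λ c∈ → Equivalence.from <rowSize⇔ (S-digits k≤1+r j<2n c<n (inS⇒S c∈)))
    (λ c<e → let 2c≤j , j≤2k = Equivalence.to <rowSize⇔ c<e in S⇒inS (k , j , c , refl , 2c≤j , j≤2k))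

  rowSize≤n : ∀ {k} j → k ≤ 1 + r → rowSize k j ≤ n
  rowSize≤n {k} j k≤1+r with j ≤? 2 * k
  ... | yes j≤2k = s≤s (≤-trans (*-cancelˡ-≤ 2 (≤-trans (2⌊n/2⌋≤n j) j≤2k)) k≤1+r)
  ... | no _     = z≤n

  countBelow-next-row : ∀ {k j} → k ≤ 1 + r → j < 2 * n →
                        countBelow (rowStart k (suc j)) ≡ countBelow (rowStart k j) + rowSize k j
  countBelow-next-row {k} {j} k≤1+r j<2n = begin
    countBelow (rowStart k (suc j))                 ≡⟨ cong countBelow (rowStart-suc k j) ⟨
    countBelow (rowStart k j + n)                   ≡⟨ countBelow-block {rowStart k j} (inS-row⇔ k≤1+r j<2n) n ≤-refl ⟩
    countBelow (rowStart k j) + n ⊓ rowSize k j     ≡⟨ cong (countBelow (rowStart k j) +_) (m≥n⇒m⊓n≡n (rowSize≤n j k≤1+r)) ⟩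
    countBelow (rowStart k j) + rowSize k j         ∎
    where open ≡-Reasoning

  countBelow-level : ∀ k j → k ≤ 1 + r → j ≤ 2 * n → countBelow (rowStart k j) ≡ sumSquares k + stairs (j ⊓ suc (2 * k))
  countBelow-level zero    zero    _ _ = refl
  countBelow-level (suc k) zero    k<1+r _ = begin
    countBelow (rowStart (suc k) 0)               ≡⟨ cong countBelow (rowStart-wrap k) ⟨
    countBelow (rowStart k (2 * n))               ≡⟨ countBelow-level k (2 * n) (<⇒≤ k<1+r) ≤-refl ⟩
    sumSquares k + stairs (2 * n ⊓ suc (2 * k))   ≡⟨ cong (λ a → sumSquares k + stairs a) (m≥n⇒m⊓n≡n 1+2k≤2n) ⟩
    sumSquares k + stairs (1 + 2 * k)             ≡⟨ cong (sumSquares k +_) (stairs-odd k) ⟩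
    sumSquares (suc k)                            ≡⟨ +-identityʳ _ ⟨
    sumSquares (suc k) + stairs 0                 ∎
    where
    open ≡-Reasoning
    1+2k≤2n : 1 + 2 * k ≤ 2 * n
    1+2k≤2n = ≤-trans (s≤s (*-monoʳ-≤ 2 (m<1+n⇒m≤n k<1+r)))
                (≤-trans (+-monoˡ-≤ (2 * r) (m≤m+n 1 3)) (≤-reflexive (sym (*-distribˡ-+ 2 2 r))))
  countBelow-level k       (suc j) k≤1+r j<2n = begin
    countBelow (rowStart k (suc j))                        ≡⟨ countBelow-next-row k≤1+r j<2n ⟩
    countBelow (rowStart k j) + rowSize k j                ≡⟨ cong (_+ rowSize k j) (countBelow-level k j k≤1+r (<⇒≤ j<2n)) ⟩
    sumSquares k + stairs (j ⊓ suc (2 * k)) + rowSize k j  ≡⟨ +-assoc (sumSquares k) _ _ ⟩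
    sumSquares k + (stairs (j ⊓ suc (2 * k)) + rowSize k j) ≡⟨ cong (sumSquares k +_) (stairs-rowSize k j) ⟩
    sumSquares k + stairs (suc j ⊓ suc (2 * k))            ∎
    where open ≡-Reasoning

  1+r≤1+2[1+r] : 1 + r ≤ suc (2 * (1 + r))
  1+r≤1+2[1+r] = ≤-trans (m≤m+n (1 + r) (1 + r + 0)) (n≤1+n _)

  1+r<2n : 1 + r < 2 * n
  1+r<2n = ≤-trans (+-mono-≤ (m≤m+n 2 2) (m≤m+n r (r + 0))) (≤-reflexive (sym (*-distribˡ-+ 2 2 r)))

  walk-row-up : ∀ {k j} → k ≤ 1 + r → j < 2 * n → 2 * rowSize k j ≤ n →
                walk (rowStart k j) ℤ.≤ walk (rowStart k (suc j))
  walk-row-up {k} {j} k≤1+r j<2n 2e≤n = subst (λ x → walk (rowStart k j) ℤ.≤ walk x) (rowStart-suc k j)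
    (walk-up (rowStart k j) n (trans (cong countBelow (rowStart-suc k j)) (countBelow-next-row k≤1+r j<2n)) 2e≤n)

  walk-row-down : ∀ {k j} → k ≤ 1 + r → j < 2 * n → n ≤ 2 * rowSize k j →
                  walk (rowStart k (suc j)) ℤ.≤ walk (rowStart k j)
  walk-row-down {k} {j} k≤1+r j<2n n≤2e = subst (λ x → walk x ℤ.≤ walk (rowStart k j)) (rowStart-suc k j)
    (walk-down (rowStart k j) n (trans (cong countBelow (rowStart-suc k j)) (countBelow-next-row k≤1+r j<2n)) n≤2e)

  walk-rises-to-middle : ∀ {k j} → k ≤ 1 + r → j ≤ 1 + r → walk (rowStart k j) ℤ.≤ walk (rowStart k (1 + r))
  walk-rises-to-middle {k} k≤1+r = ℤ-≤-by-steps (walk ∘ rowStart k) step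
    where
    step : ∀ i → _ → i < 1 + r → walk (rowStart k i) ℤ.≤ walk (rowStart k (suc i))
    step i _ i<1+r = walk-row-up k≤1+r (<-trans i<1+r 1+r<2n) (begin
      2 * rowSize k i         ≤⟨ *-monoʳ-≤ 2 (rowSize≤1+⌊j/2⌋ k i) ⟩
      2 * suc ⌊ i /2⌋         ≡⟨ *-suc 2 ⌊ i /2⌋ ⟩
      2 + 2 * ⌊ i /2⌋         ≤⟨ +-monoʳ-≤ 2 (≤-trans (2⌊n/2⌋≤n i) (m<1+n⇒m≤n i<1+r)) ⟩
      n                       ∎)
      where open ≤-Reasoning

  walk-falls-from-middle : ∀ {k j} → k ≤ 1 + r → 1 + r ≤ j → j ≤ 1 + 2 * k →
                           walk (rowStart k j) ℤ.≤ walk (rowStart k (1 + r))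
  walk-falls-from-middle {k} {j} k≤1+r 1+r≤j j≤1+2k = ℤ-≥-by-steps (walk ∘ rowStart k) step 1+r≤j
    where
    step : ∀ i → 1 + r ≤ i → i < j → walk (rowStart k (suc i)) ℤ.≤ walk (rowStart k i)
    step i 1+r≤i i<j = walk-row-down k≤1+r i<2n (begin
      n                       ≤⟨ +-monoʳ-≤ 1 (≤-trans 1+r≤i (n≤1+2⌊n/2⌋ i)) ⟩
      2 + 2 * ⌊ i /2⌋         ≡⟨ *-suc 2 ⌊ i /2⌋ ⟨
      2 * suc ⌊ i /2⌋         ≡⟨ cong (2 *_) (rowSize-low i≤2k) ⟨
      2 * rowSize k i         ∎)
      where
      open ≤-Reasoning
      i≤2k = m<1+n⇒m≤n (<-≤-trans i<j j≤1+2k)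
      i<2n = ≤-<-trans i≤2k (*-monoʳ-< 2 (s≤s k≤1+r))

  walk-rises-to-end : ∀ {k j} → k ≤ 1 + r → 1 + 2 * k ≤ j → j ≤ 2 * n →
                      walk (rowStart k j) ℤ.≤ walk (rowStart k (2 * n))
  walk-rises-to-end {k} {j} k≤1+r 1+2k≤j = ℤ-≤-by-steps (walk ∘ rowStart k) step
    where
    step : ∀ i → j ≤ i → i < 2 * n → walk (rowStart k i) ℤ.≤ walk (rowStart k (suc i))
    step i j≤i i<2n = walk-row-up k≤1+r i<2n
      (≤-trans (≤-reflexive (cong (2 *_) (rowSize-high (<⇒≱ (≤-trans 1+2k≤j j≤i))))) z≤n)

  walk-in-level : ∀ {k j} → k ≤ 1 + r → j ≤ 2 * n →
                  walk (rowStart k j) ℤ.≤ walk (rowStart k (1 + r)) ⊎ walk (rowStart k j) ℤ.≤ walk (rowStart k (2 * n))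
  walk-in-level {k} {j} k≤1+r j≤2n with j ≤? 1 + r | j ≤? 1 + 2 * k
  ... | yes j≤1+r | _          = inj₁ (walk-rises-to-middle k≤1+r j≤1+r)
  ... | no j≰1+r  | yes j≤1+2k = inj₁ (walk-falls-from-middle k≤1+r (<⇒≤ (≰⇒> j≰1+r)) j≤1+2k)
  ... | no _      | no j≰1+2k  = inj₂ (walk-rises-to-end k≤1+r (<⇒≤ (≰⇒> j≰1+2k)) j≤2n)

  level-gain : ∀ {k} → k < 1 + r →
               suc k * suc k + stairs ((1 + r) ⊓ suc (2 * suc k)) ≤ n * n + stairs ((1 + r) ⊓ suc (2 * k))
  level-gain {k} k<1+r with 1 + r ≤? suc (2 * k)
  ... | yes 1+r≤1+2k = begin
    suc k * suc k + stairs ((1 + r) ⊓ suc (2 * suc k))  ≡⟨ cong (λ a → suc k * suc k + stairs a) (m≤n⇒m⊓n≡m 1+r≤1+2k+2) ⟩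
    suc k * suc k + stairs (1 + r)                       ≤⟨ +-monoˡ-≤ (stairs (1 + r)) (*-mono-≤ k+1≤n k+1≤n) ⟩
    n * n + stairs (1 + r)                               ≡⟨ cong (λ a → n * n + stairs a) (m≤n⇒m⊓n≡m 1+r≤1+2k) ⟨
    n * n + stairs ((1 + r) ⊓ suc (2 * k))               ∎
    where
    open ≤-Reasoning
    k+1≤n = ≤-trans k<1+r (n≤1+n (1 + r))
    1+r≤1+2k+2 = ≤-trans 1+r≤1+2k (s≤s (*-monoʳ-≤ 2 (n≤1+n k)))
  ... | no 1+r≰1+2k = begin
    suc k * suc k + stairs ((1 + r) ⊓ suc (2 * suc k))  ≤⟨ +-monoʳ-≤ (suc k * suc k) (stairs-mono (m⊓n≤n (1 + r) _)) ⟩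
    suc k * suc k + stairs (1 + 2 * suc k)              ≡⟨ cong (suc k * suc k +_) (stairs-odd (suc k)) ⟩
    suc k * suc k + suc (suc k) * suc (suc k)           ≤⟨ +-monoʳ-≤ (suc k * suc k) (*-mono-≤ k+2≤n k+2≤n) ⟩
    suc k * suc k + n * n                               ≡⟨ +-comm (suc k * suc k) (n * n) ⟩
    n * n + suc k * suc k                               ≡⟨ cong (n * n +_) (stairs-odd k) ⟨
    n * n + stairs (1 + 2 * k)                          ≡⟨ cong (λ a → n * n + stairs a) (m≥n⇒m⊓n≡n 1+2k≤1+r) ⟨
    n * n + stairs ((1 + r) ⊓ suc (2 * k))              ∎
    where
    open ≤-Reasoning
    k+2≤n = s≤s k<1+r
    1+2k≤1+r = <⇒≤ (≰⇒> 1+r≰1+2k)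

  walk-climbs-level : ∀ {k} → k < 1 + r → walk (rowStart k (1 + r)) ℤ.≤ walk (rowStart (suc k) (1 + r))
  walk-climbs-level {k} k<1+r = walk-≤ (rowStart k (1 + r)) (rowStart (suc k) (1 + r)) (begin
    rowStart k (1 + r) + 2 * countBelow (rowStart (suc k) (1 + r))
      ≡⟨ cong (λ a → rowStart k (1 + r) + 2 * a) (countBelow-level (suc k) (1 + r) k<1+r (<⇒≤ 1+r<2n)) ⟩
    rowStart k (1 + r) + 2 * (sumSquares k + suc k * suc k + A′)
      ≡⟨ split (rowStart k (1 + r)) (sumSquares k) (suc k * suc k) A′ ⟩
    rowStart k (1 + r) + 2 * sumSquares k + 2 * (suc k * suc k + A′)
      ≤⟨ +-monoʳ-≤ _ (*-monoʳ-≤ 2 (level-gain k<1+r)) ⟩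
    rowStart k (1 + r) + 2 * sumSquares k + 2 * (n * n + A)
      ≡⟨ climb k r (sumSquares k) A ⟩
    rowStart (suc k) (1 + r) + 2 * (sumSquares k + A)
      ≡⟨ cong (λ a → rowStart (suc k) (1 + r) + 2 * a) (countBelow-level k (1 + r) (<⇒≤ k<1+r) (<⇒≤ 1+r<2n)) ⟨
    rowStart (suc k) (1 + r) + 2 * countBelow (rowStart k (1 + r)) ∎)
    where
    open ≤-Reasoning
    A = stairs ((1 + r) ⊓ suc (2 * k))
    A′ = stairs ((1 + r) ⊓ suc (2 * suc k))
    split : ∀ x S B C → x + 2 * (S + B + C) ≡ x + 2 * S + 2 * (B + C)
    split = solve-∀
    climb : ∀ k r S A → k * (2 * (2 + r) * (2 + r)) + (1 + r) * (2 + r) + 2 * S + 2 * ((2 + r) * (2 + r) + A)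
                        ≡ suc k * (2 * (2 + r) * (2 + r)) + (1 + r) * (2 + r) + 2 * (S + A)
    climb = solve-∀

  walk-top-level-end : walk (rowStart (1 + r) (2 * n)) ℤ.≤ walk (rowStart (1 + r) (1 + r))
  walk-top-level-end = walk-≤ (rowStart (1 + r) (2 * n)) (rowStart (1 + r) (1 + r)) (begin
    rowStart (1 + r) (2 * n) + 2 * countBelow (rowStart (1 + r) (1 + r))
      ≡⟨ cong (λ a → rowStart (1 + r) (2 * n) + 2 * a) (countBelow-level (1 + r) (1 + r) ≤-refl (<⇒≤ 1+r<2n)) ⟩
    rowStart (1 + r) (2 * n) + 2 * (S₁ + stairs ((1 + r) ⊓ suc (2 * (1 + r))))
      ≡⟨ cong (λ a → rowStart (1 + r) (2 * n) + 2 * (S₁ + stairs a)) (m≤n⇒m⊓n≡m 1+r≤1+2[1+r]) ⟩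
    rowStart (1 + r) (2 * n) + 2 * (S₁ + stairs (1 + r))
      ≡⟨ shuffle (1 + r) n S₁ (stairs (1 + r)) ⟩
    (1 + r) * q + 2 * S₁ + (2 * n * n + 2 * stairs (1 + r))
      ≤⟨ +-monoʳ-≤ ((1 + r) * q + 2 * S₁) (+-monoʳ-≤ (2 * n * n) (2*stairs≤ (1 + r))) ⟩
    (1 + r) * q + 2 * S₁ + (2 * n * n + (1 + r) * n)
      ≡⟨ shuffle′ (1 + r) n S₁ ⟩
    rowStart (1 + r) (1 + r) + 2 * (S₁ + n * n)
      ≡⟨ cong (λ a → rowStart (1 + r) (1 + r) + 2 * (S₁ + a)) (stairs-odd (1 + r)) ⟨
    rowStart (1 + r) (1 + r) + 2 * (S₁ + stairs (1 + 2 * (1 + r)))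
      ≡⟨ cong (λ a → rowStart (1 + r) (1 + r) + 2 * (S₁ + stairs a)) (m≥n⇒m⊓n≡n (<⇒≤ 1+2[1+r]<2n)) ⟨
    rowStart (1 + r) (1 + r) + 2 * (S₁ + stairs (2 * n ⊓ suc (2 * (1 + r))))
      ≡⟨ cong (λ a → rowStart (1 + r) (1 + r) + 2 * a) (countBelow-level (1 + r) (2 * n) ≤-refl ≤-refl) ⟨
    rowStart (1 + r) (1 + r) + 2 * countBelow (rowStart (1 + r) (2 * n)) ∎)
    where
    open ≤-Reasoning
    S₁ = sumSquares (1 + r)
    1+2[1+r]<2n : 1 + 2 * (1 + r) < 2 * n
    1+2[1+r]<2n = ≤-reflexive (sym (*-suc 2 (1 + r)))
    shuffle : ∀ k n S A → k * (2 * n * n) + 2 * n * n + 2 * (S + A) ≡ k * (2 * n * n) + 2 * S + (2 * n * n + 2 * A)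
    shuffle = solve-∀
    shuffle′ : ∀ k n S → k * (2 * n * n) + 2 * S + (2 * n * n + k * n) ≡ k * (2 * n * n) + k * n + 2 * (S + n * n)
    shuffle′ = solve-∀

  -- written as in the statement; n ∸ 1 reduces to 1 + r
  s : ℕ
  s = (n ∸ 1) * (q + n)

  s≡rowStart : s ≡ rowStart (1 + r) (1 + r)
  s≡rowStart = *-distribˡ-+ (suc r) q n

  walk-middle-≤-s : ∀ {k} → k ≤ 1 + r → walk (rowStart k (1 + r)) ℤ.≤ walk s
  walk-middle-≤-s {k} k≤1+r = subst (λ x → walk (rowStart k (1 + r)) ℤ.≤ walk x) (sym s≡rowStart)
    (ℤ-≤-by-steps (λ i → walk (rowStart i (1 + r))) (λ _ _ i<1+r → walk-climbs-level i<1+r) k≤1+r)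

  walk-rowStart-≤-s : ∀ {k j} → k ≤ 1 + r → j ≤ 2 * n → walk (rowStart k j) ℤ.≤ walk s
  walk-rowStart-≤-s {k} {j} k≤1+r j≤2n with walk-in-level k≤1+r j≤2n
  ... | inj₁ ≤middle = ℤP.≤-trans ≤middle (walk-middle-≤-s k≤1+r)
  ... | inj₂ ≤end = ℤP.≤-trans ≤end end≤s
    where
    end≤s : walk (rowStart k (2 * n)) ℤ.≤ walk s
    end≤s with k ≤? r
    ... | yes k≤r = subst (λ x → walk x ℤ.≤ walk s) (sym (rowStart-wrap k))
                      (ℤP.≤-trans (walk-rises-to-middle (s≤s k≤r) z≤n) (walk-middle-≤-s (s≤s k≤r)))
    ... | no k≰r  = subst (λ i → walk (rowStart i (2 * n)) ℤ.≤ walk s) (sym (≤-antisym k≤1+r (≰⇒> k≰r)))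
                      (ℤP.≤-trans walk-top-level-end (walk-middle-≤-s ≤-refl))

  walk-lower-half : ∀ t → t ≤ (2 + r) * q → walk t ℤ.≤ walk s
  walk-lower-half zero    _   = walk-rowStart-≤-s {0} {0} z≤n z≤n
  walk-lower-half (suc t) t<X with digits t
  ... | k , j , c , j<2n , c<n , refl =
    subst (ℤ._≤ walk s) (cong walk (+-suc (rowStart k j) c))
      ([ (λ ≤start → ℤP.≤-trans ≤start (walk-rowStart-≤-s k≤1+r (<⇒≤ j<2n)))
       , (λ ≤next → ℤP.≤-trans ≤next (subst (λ x → walk x ℤ.≤ walk s) (sym (rowStart-suc k j)) (walk-rowStart-≤-s k≤1+r j<2n)))
       ]′ (walk-block {rowStart k j} (inS-row⇔ k≤1+r j<2n) (suc c) c<n))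
    where
    k≤1+r = m<1+n⇒m≤n (level-< {k} {j} {c} t<X)

  walk-max : ∀ t → t ≤ suc F → walk t ℤ.≤ walk s
  walk-max t t≤1+F with t ≤? (2 + r) * q
  ... | yes t≤X = walk-lower-half t t≤X
  ... | no t≰X  = subst (ℤ._≤ walk s) (sym (walk-symmetric inS-symmetric t u t+u≡))
                    (walk-lower-half u (<⇒≤ u<X))
    where
    X = (2 + r) * q
    u = suc F ∸ t
    t+u≡ : t + u ≡ suc F
    t+u≡ = m+[n∸m]≡n t≤1+F
    u<X : u < X
    u<X = +-cancelˡ-< X u X (begin-strict
      X + u     <⟨ +-monoˡ-< u (≰⇒> t≰X) ⟩
      t + u     ≡⟨ t+u≡ ⟩
      suc F     ≤⟨ F<2[2+r]q ⟩
      X + X     ∎)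
      where open ≤-Reasoning

  s∈S : T (inS s)
  s∈S = S⇒inS {s} (1 + r , 1 + r , 0 , trans s≡rowStart (sym (+-identityʳ _)) , z≤n , m≤n*m (1 + r) 2)

  s≤1+F : s ≤ suc F
  s≤1+F = ≤-trans (m≤m+n s ((2 + r) * q + r * n + (2 + r))) (≤-reflexive (gap r))
    where
    gap : ∀ r → suc r * (2 * (2 + r) * (2 + r) + (2 + r)) + ((2 + r) * (2 * (2 + r) * (2 + r)) + r * (2 + r) + (2 + r))
                ≡ suc ((3 + 2 * r) * (2 * (2 + r) * (2 + r)) + (1 + 2 * r) * (2 + r) + (1 + r))
    gap = solve-∀

  opaque
    unfolding inS

    isFrobenius : IsFrobenius (gens n q) F
    isFrobenius = F∉S ∘ inS⇒S {F} , λ x F<x → S⇒inS {x} (>F⇒S x F<x)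

    s∈gens : s ∈⟨ gens n q ⟩
    s∈gens = s∈S

    σ-max : ∀ t → t ∈⟨ gens n q ⟩ → t ≤ suc F → σ (gens n q) t ℚ.≤ σ (gens n q) s
    σ-max t t∈S t≤1+F = σ-mono (gens n q) t s (subst₂ ℤ._≤_ (sym (walk-suc-∈ {t} t∈S)) (sym (walk-suc-∈ {s} s∈S))
      (ℤP.+-monoˡ-≤ (ℤ.- ℤ.1ℤ) (walk-max t t≤1+F)))

    σ-s≡ : ∀ N → ℤ.+ 6 ℤ.* walk s ≡ N → σ (gens n q) s ≡ N ℚ./ 12
    σ-s≡ N 6w≡N = σ-≡ (gens n q) s N (trans (cong (λ w → ℤ.+ 6 ℤ.* (w ℤ.+ ℤ.1ℤ)) (walk-suc-∈ {s} s∈S))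
      (trans (cong (ℤ.+ 6 ℤ.*_) (back (walk s))) 6w≡N))
      where
      back : ∀ w → w ℤ.- ℤ.1ℤ ℤ.+ ℤ.1ℤ ≡ w
      back = ℤ-Solver.solve-∀

  countBelow-s : countBelow s ≡ sumSquares (1 + r) + stairs (1 + r)
  countBelow-s = trans (cong countBelow s≡rowStart)
    (trans (countBelow-level (1 + r) (1 + r) ≤-refl (<⇒≤ 1+r<2n))
           (cong (λ a → sumSquares (1 + r) + stairs a) (m≤n⇒m⊓n≡m 1+r≤1+2[1+r])))

module _ (p : ℕ) where

  open Suzuki (2 * p)

  m : ℕ
  m = 18 + 58 * p + 32 * p * p

  6*s≡ : 6 * s ≡ n * m + 6 * (2 * countBelow s)
  6*s≡ = begin
    6 * s                                                          ≡⟨ expand p ⟩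
    n * m + (2 * (k * suc k * (1 + 2 * k)) + 12 * (suc p * suc p))   ≡⟨ cong₂ (λ a b → n * m + (2 * a + 12 * b))
                                                                            (6*sumSquares k) (stairs-odd p) ⟨
    n * m + (2 * (6 * sumSquares k) + 12 * stairs k)               ≡⟨ cong (n * m +_) (regroup (sumSquares k) (stairs k)) ⟩
    n * m + 6 * (2 * (sumSquares k + stairs k))                    ≡⟨ cong (λ a → n * m + 6 * (2 * a)) countBelow-s ⟨
    n * m + 6 * (2 * countBelow s)                                 ∎
    where
    open ≡-Reasoning
    k = 1 + 2 * p
    expand : ∀ p → 6 * (suc (2 * p) * (2 * (2 + 2 * p) * (2 + 2 * p) + (2 + 2 * p)))
                   ≡ (2 + 2 * p) * (18 + 58 * p + 32 * p * p)
                     + (2 * ((1 + 2 * p) * suc (1 + 2 * p) * (1 + 2 * (1 + 2 * p))) + 12 * (suc p * suc p))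
    expand = solve-∀
    regroup : ∀ S A → 2 * (6 * S) + 12 * A ≡ 6 * (2 * (S + A))
    regroup = solve-∀

  4q≡m+8+3n : 4 * q ≡ m + 8 + 3 * n
  4q≡m+8+3n = identity p
    where
    identity : ∀ p → 4 * (2 * (2 + 2 * p) * (2 + 2 * p)) ≡ 18 + 58 * p + 32 * p * p + 8 + 3 * (2 + 2 * p)
    identity = solve-∀

  σ-s : σ (gens n q) s ≡ (ℤ.+ n ℤ.* ((ℤ.+ (4 * q) ℤ.- ℤ.+ (3 * n)) ℤ.- ℤ.+ 8)) ℚ./ 12
  σ-s = σ-s≡ _ (begin
    ℤ.+ 6 ℤ.* walk s
      ≡⟨ +k*[+a-+b] 6 s (2 * countBelow s) ⟩
    ℤ.+ (6 * s) ℤ.- ℤ.+ (6 * (2 * countBelow s))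
      ≡⟨ +a-+c≡+b {6 * s} {n * m} {6 * (2 * countBelow s)} 6*s≡ ⟩
    ℤ.+ (n * m)
      ≡⟨ ℤP.pos-* n m ⟩
    ℤ.+ n ℤ.* ℤ.+ m
      ≡⟨ cong (ℤ.+ n ℤ.*_) (trans (cong (ℤ._- ℤ.+ 8) (+a-+c≡+b {4 * q} {m + 8} {3 * n} 4q≡m+8+3n))
                                 (+a-+c≡+b {m + 8} {m} {8} refl)) ⟨
    ℤ.+ n ℤ.* ((ℤ.+ (4 * q) ℤ.- ℤ.+ (3 * n)) ℤ.- ℤ.+ 8) ∎)
    where open ≡-Reasoning

Corollary : ℕ → Set
Corollary n = Σ ℕ (λ F → IsFrobenius (gens n (2 * n * n)) F
      × ((n ∸ 1) * (2 * n * n + n)) ∈⟨ gens n (2 * n * n) ⟩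
      × (n ∸ 1) * (2 * n * n + n) ≤ suc F
      × (∀ t → t ∈⟨ gens n (2 * n * n) ⟩ → t ≤ suc F →
           σ (gens n (2 * n * n)) t ℚ.≤ σ (gens n (2 * n * n)) ((n ∸ 1) * (2 * n * n + n)))
      × σ (gens n (2 * n * n)) ((n ∸ 1) * (2 * n * n + n))
          ≡ (ℤ.+ n ℤ.* ((ℤ.+ (4 * (2 * n * n)) ℤ.- ℤ.+ (3 * n)) ℤ.- ℤ.+ 8)) ℚ./ 12)

corollary-even : ∀ p → Corollary (2 + 2 * p)
corollary-even p = F , isFrobenius , s∈gens , s≤1+F , σ-max , σ-s p
  where open Suzuki (2 * p)

2^[1+h]-even : ∀ h → ∃[ p ] 2 * 2 ^ h ≡ 2 + 2 * p
2^[1+h]-even h with 2 ^ h | m^n>0 2 h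
... | suc p | _ = p , *-suc 2 p

open import Defs using (q₀; q; suzuki)
open import Data.Integer using (+_)

corollary4p13 : (h : ℕ) → 1 ≤ h →
    Σ ℕ (λ F → IsFrobenius (suzuki h) F
      × ((q₀ h ∸ 1) * (q h + q₀ h)) ∈⟨ suzuki h ⟩
      × (q₀ h ∸ 1) * (q h + q₀ h) ≤ suc F
      × (∀ t → t ∈⟨ suzuki h ⟩ → t ≤ suc F →
           σ (suzuki h) t ℚ.≤ σ (suzuki h) ((q₀ h ∸ 1) * (q h + q₀ h)))
      × σ (suzuki h) ((q₀ h ∸ 1) * (q h + q₀ h))
          ≡ (+ q₀ h ℤ.* ((+ (4 * q h) ℤ.- + (3 * q₀ h)) ℤ.- + 8)) ℚ./ 12)
corollary4p13 (suc h) _ = subst Corollary (sym (proj₂ q₀-even)) (corollary-even (proj₁ q₀-even))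
  where
  q₀-even = 2^[1+h]-even h
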